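{- Let $L_{\mathrm{Rect}}$ be the set of nonempty words $w = w_1 w_2 \cdots w_m$ over the alphabet $\{1,2,u,d\}$ such that the composition $\psi_{w_1} \circ \psi_{w_2} \circ \cdots \circ \psi_{w_m}$ can be applied to $e_0$, i.e. setting $\sigma_0 = e_0$ and $\sigma_j = \psi_{w_{m-j+1}}(\sigma_{j-1})$, each $\sigma_{j-1}$ lies in the domain of $\psi_{w_{m-j+1}}$. Then: (1) $L_{\mathrm{Rect}}$ is exactly the set of words over $\{1,2,u,d\}$ that end in the letter $1$ and contain neither $21$ nor $u1$ as a factor (consecutive subword); (2) $L_{\mathrm{Rect}}$ is the language described by the regular expression $(1^*(2|u)^*d)^*1^+$.
   Context: Permutations are written in one-line form; $S_0$ consists of the empty permutation $e_0$. A permutation is rectangular if it avoids each of the patterns $2413, 2431, 4213, 4231$ (no subsequence has the same relative order as one of them). For $\pi \in S_n$ and $1 \le i, j \le n+1$, $\rho_{i,j}(\pi) \in S_{n+1}$ is obtained by increasing by $1$ every entry of $\pi$ that is $\ge i$ and then inserting the value $i$ so that it occupies position $j$. Define operators on rectangular permutations: $\psi_1 = \rho_{1,1}$, with domain all rectangular permutations (of any size $n\ge 0$); $\psi_2 = \rho_{1,2}$, with domain the rectangular permutations $\pi$ of size at least $2$ with $\pi_1 \neq 1$; $\psi_u(\pi) = \rho_{\pi_1,1}(\pi)$, with domain the rectangular permutations $\pi$ of size at least $2$ with $\pi_1 \ne 1$; $\psi_d(\pi) = \rho_{\pi_1+1,1}(\pi)$, with domain the rectangular permutations of size at least $1$.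 In a regular expression, $|$ denotes alternation, $^*$ zero or more repetitions, $^+$ one or more repetitions, and juxtaposition concatenation. -}

module Defs where

open import Data.Nat using (ℕ; zero; suc; _<_; _≤_; _≤ᵇ_; _∸_)
open import Data.Bool using (if_then_else_)
open import Data.List using (List; []; _∷_; _++_; map; length; lookup; [_])
open import Data.List.Relation.Binary.Sublist.Propositional using (_⊆_)
open import Data.Fin using (Fin; cast)
open import Data.Product using (Σ; ∃; _×_)
open import Data.Empty using (⊥)
open import Relation.Nullary using (¬_)
open import Relation.Binary.PropositionalEquality using (_≡_; _≢_)
open import Function.Bundles using (_⇔_)

-- Permutations in one-line form, as lists of natural numbers (values 1..n).
Perm : Set
Perm = List ℕ

OrderIso : List ℕ → List ℕ → Set
OrderIso ys p = Σ (length ys ≡ length p) λ eq →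
  (i j : Fin (length ys)) →
    (lookup ys i < lookup ys j) ⇔ (lookup p (cast eq i) < lookup p (cast eq j))

Contains : Perm → List ℕ → Set
Contains π p = ∃ λ ys → ys ⊆ π × OrderIso ys p

Avoids : Perm → List ℕ → Set
Avoids π p = ¬ Contains π p

Rect : Perm → Set
Rect π = Avoids π (2 ∷ 4 ∷ 1 ∷ 3 ∷ []) × Avoids π (2 ∷ 4 ∷ 3 ∷ 1 ∷ [])
       × Avoids π (4 ∷ 2 ∷ 1 ∷ 3 ∷ []) × Avoids π (4 ∷ 2 ∷ 3 ∷ 1 ∷ [])

bump : ℕ → ℕ → ℕ
bump i x = if i ≤ᵇ x then suc x else x

insertAt : ℕ → ℕ → List ℕ → List ℕ
insertAt zero x l = x ∷ l
insertAt (suc k) x [] = x ∷ []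
insertAt (suc k) x (y ∷ l) = y ∷ insertAt k x l

-- ρ i j π, with 1-indexed position j
ρ : ℕ → ℕ → Perm → Perm
ρ i j π = insertAt (j ∸ 1) i (map (bump i) π)

data Letter : Set where
  L1 L2 Lu Ld : Letter

-- first entry π₁ (default 0 for the empty permutation; never used there)
first : Perm → ℕ
first [] = 0
first (a ∷ _) = a

BigNot1 : Perm → Set
BigNot1 π = ∃ λ a → ∃ λ b → ∃ λ rest → π ≡ a ∷ b ∷ rest × a ≢ 1

NonEmpty : Perm → Set
NonEmpty π = ∃ λ a → ∃ λ rest → π ≡ a ∷ rest

ψ : Letter → Perm → Perm
ψ L1 π = ρ 1 1 π
ψ L2 π = ρ 1 2 π
ψ Lu π = ρ (first π) 1 π
ψ Ld π = ρ (suc (first π)) 1 π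

Dom : Letter → Perm → Set
Dom L1 π = Rect π
Dom L2 π = Rect π × BigNot1 π
Dom Lu π = Rect π × BigNot1 π
Dom Ld π = Rect π × NonEmpty π

data Applies : List Letter → Perm → Set where
  a-nil  : Applies [] []
  a-cons : ∀ {x w π} → Applies w π → Dom x π → Applies (x ∷ w) (ψ x π)

LRect : List Letter → Set
LRect w = w ≢ [] × ∃ λ σ → Applies w σ

EndsIn1 : List Letter → Set
EndsIn1 w = ∃ λ v → w ≡ v ++ [ L1 ]

HasFactor : List Letter → List Letter → Set
HasFactor w f = ∃ λ p → ∃ λ s → w ≡ p ++ f ++ s

Desc1 : List Letter → Set
Desc1 w = EndsIn1 w × ¬ HasFactor w (L2 ∷ L1 ∷ []) × ¬ HasFactor w (Lu ∷ L1 ∷ [])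

data Regex : Set where
  ∅ᴿ   : Regex
  εᴿ   : Regex
  chr  : Letter → Regex
  _∣ᴿ_ : Regex → Regex → Regex
  _·ᴿ_ : Regex → Regex → Regex
  _*ᴿ  : Regex → Regex

_⁺ᴿ : Regex → Regex
r ⁺ᴿ = r ·ᴿ (r *ᴿ)

data _∈ᴿ_ : List Letter → Regex → Set where
  m-ε    : [] ∈ᴿ εᴿ
  m-chr  : ∀ {c} → [ c ] ∈ᴿ chr c
  m-altˡ : ∀ {w r s} → w ∈ᴿ r → w ∈ᴿ (r ∣ᴿ s)
  m-altʳ : ∀ {w r s} → w ∈ᴿ s → w ∈ᴿ (r ∣ᴿ s)
  m-cat  : ∀ {u v r s} → u ∈ᴿ r → v ∈ᴿ s → (u ++ v) ∈ᴿ (r ·ᴿ s)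
  m-nil  : ∀ {r} → [] ∈ᴿ (r *ᴿ)
  m-star : ∀ {u v r} → u ∈ᴿ r → v ∈ᴿ (r *ᴿ) → (u ++ v) ∈ᴿ (r *ᴿ)

RectRegex : Regex
RectRegex = (((((chr L1) *ᴿ) ·ᴿ (((chr L2) ∣ᴿ (chr Lu)) *ᴿ)) ·ᴿ (chr Ld)) *ᴿ) ·ᴿ ((chr L1) ⁺ᴿ)

-- Reading a word from the right, ψ₁ and ψ_d can always be applied to a rectangular
-- permutation, while ψ₂ and ψᵤ need π₁ ≠ 1, which fails exactly right after a ψ₁.
-- That syntactic condition is the whole story because every ψ preserves
-- rectangularity.  Each of 2413, 2431, 4213, 4231 has, among its last two entries, one
-- below both first entries and one strictly between them.  Hence the minimum 1 that
-- ψ₁ and ψ₂ insert among the first two places lies in no occurrence; and ψᵤ, ψ_d put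
-- in front a value adjacent to the old first entry, so no occurrence uses both of
-- them and an occurrence using the new one moves to the old one.
-- Along the way the entries stay positive and pairwise distinct.

module Submission where

open import Defs
open import Data.Nat using (ℕ; zero; suc; _∸_; _<_; _≤_; _≤?_; _≤ᵇ_; z≤n; s≤s; s≤s⁻¹; z<s; s<s)
open import Data.Nat.Properties
  using (≤ᵇ⇒≤; ≤⇒≤ᵇ; ≰⇒>; <⇒≱; <-asym; <-irrefl; <-trans; <-cmp; ≤-trans; ≤-refl; ≤∧≢⇒<;
         n<1+n; n≤1+n; m<n⇒m<1+n; m<1+n⇒m≤n; suc-injective)
open import Data.Bool using (true; false; T)
open import Data.Unit using (tt)
open import Data.Empty using (⊥-elim)
open import Data.Product using (Σ; ∃; _×_; _,_; proj₁; proj₂)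
open import Data.Sum using (_⊎_; inj₁; inj₂)
import Data.Sum as Sum
open import Data.Fin using (zero; suc; #_)
open import Data.List using (List; []; _∷_; _++_; map; length; lookup; [_])
open import Data.List.Properties using (++-assoc; ∷-injectiveˡ; ∷-injectiveʳ)
open import Data.List.Relation.Unary.All as All using (All; []; _∷_)
import Data.List.Relation.Unary.All.Properties as All
open import Data.List.Relation.Unary.AllPairs using ([]; _∷_)
open import Data.List.Relation.Unary.Unique.Propositional using (Unique)
import Data.List.Relation.Unary.Unique.Propositional.Properties as Unique
open import Data.List.Relation.Binary.Pointwise using (Pointwise; []; _∷_)
open import Data.List.Relation.Binary.Sublist.Propositional using (_⊆_; []; _∷_; _∷ʳ_)
open import Data.List.Relation.Binary.Sublist.Propositional.Properties using (All-resp-⊆)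
open import Relation.Nullary using (¬_; yes; no)
open import Relation.Binary.Definitions using (tri<; tri≈; tri>)
open import Relation.Binary.PropositionalEquality hiding ([_])
open import Function.Base using (_∘_; case_of_)
open import Function.Bundles using (_⇔_; mk⇔; Equivalence)
import Function.Properties.Equivalence as ⇔

open Equivalence using (to; from)

private
  variable
    a b c d h h' i x : ℕ
    π σ rest : Perm
    p : List ℕ
    y : Letter
    w : List Letter

both-hold : ∀ {A B : Set} → A → B → A ⇔ B
both-hold a b = mk⇔ (λ _ → b) (λ _ → a)

both-fail : ∀ {A B : Set} → ¬ A → ¬ B → A ⇔ B
both-fail ¬a ¬b = mk⇔ (λ a → ⊥-elim (¬a a)) (λ b → ⊥-elim (¬b b))

bump-above : i ≤ x → bump i x ≡ suc x
bump-above {i} {x} i≤x with i ≤ᵇ x | ≤⇒≤ᵇ i≤x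
... | true | _ = refl

bump-below : x < i → bump i x ≡ x
bump-below {x} {i} x<i with i ≤ᵇ x in eq
... | false = refl
... | true  = ⊥-elim (<⇒≱ x<i (≤ᵇ⇒≤ i x (subst T (sym eq) tt)))

bump-cases : ∀ i x → (i ≤ x × bump i x ≡ suc x) ⊎ (x < i × bump i x ≡ x)
bump-cases i x with i ≤? x
... | yes i≤x = inj₁ (i≤x , bump-above i≤x)
... | no  i≰x = inj₂ (≰⇒> i≰x , bump-below (≰⇒> i≰x))

StrictlyMonotone : (ℕ → ℕ) → Set
StrictlyMonotone f = ∀ {x y} → (x < y) ⇔ (f x < f y)

bump-strictlyMonotone : ∀ i → StrictlyMonotone (bump i)
bump-strictlyMonotone i {x} {y} with bump-cases i x | bump-cases i y
... | inj₁ (_ , ex) | inj₁ (_ , ey) rewrite ex | ey = mk⇔ s≤s s≤s⁻¹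
... | inj₂ (_ , ex) | inj₂ (_ , ey) rewrite ex | ey = ⇔.refl
... | inj₁ (i≤x , ex) | inj₂ (y<i , ey) rewrite ex | ey =
  both-fail (λ x<y → <⇒≱ (<-trans x<y y<i) i≤x)
            (λ 1+x<y → <⇒≱ (<-trans (<-trans (n<1+n x) 1+x<y) y<i) i≤x)
... | inj₂ (x<i , ex) | inj₁ (i≤y , ey) rewrite ex | ey =
  both-hold (≤-trans x<i i≤y) (m<n⇒m<1+n (≤-trans x<i i≤y))

bump-injective : ∀ i {x y} → bump i x ≡ bump i y → x ≡ y
bump-injective i {x} {y} e with <-cmp x y
... | tri< x<y _ _ = ⊥-elim (<-irrefl e (to (bump-strictlyMonotone i) x<y))
... | tri≈ _ x≡y _ = x≡y
... | tri> _ _ y<x = ⊥-elim (<-irrefl (sym e) (to (bump-strictlyMonotone i) y<x))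

i≢bump : ∀ i x → i ≢ bump i x
i≢bump i x i≡ with bump-cases i x
... | inj₁ (i≤x , e) = <⇒≱ (n<1+n x) (subst (_≤ x) (trans i≡ e) i≤x)
... | inj₂ (x<i , e) = <-irrefl (sym (trans i≡ e)) x<i

≤-bump : ∀ i x → x ≤ bump i x
≤-bump i x with bump-cases i x
... | inj₁ (_ , e) rewrite e = n≤1+n x
... | inj₂ (_ , e) rewrite e = ≤-refl

Positive : List ℕ → Set
Positive = All (1 ≤_)

PositiveUnique : List ℕ → Set
PositiveUnique π = Positive π × Unique π

All-insertAt : ∀ {P : ℕ → Set} k {l} → P x → All P l → All P (insertAt k x l)
All-insertAt zero    px pl        = px ∷ pl
All-insertAt (suc k) px []        = px ∷ []
All-insertAt (suc k) px (py ∷ pl) = py ∷ All-insertAt k px pl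

Unique-insertAt : ∀ k {l} → All (x ≢_) l → Unique l → Unique (insertAt k x l)
Unique-insertAt zero    x∉l         ul         = x∉l ∷ ul
Unique-insertAt (suc k) []          []         = [] ∷ []
Unique-insertAt (suc k) (x≢y ∷ x∉l) (y∉l ∷ ul) =
  All-insertAt k (≢-sym x≢y) y∉l ∷ Unique-insertAt k x∉l ul

ρ-nonEmpty : ∀ i j π → NonEmpty (ρ i j π)
ρ-nonEmpty i j π = go (j ∸ 1) (map (bump i) π)
  where
  go : ∀ k l → NonEmpty (insertAt k i l)
  go zero    l       = i , l , refl
  go (suc k) []      = i , [] , refl
  go (suc k) (x ∷ l) = x , _ , refl

positive-bump : ∀ i → Positive π → Positive (map (bump i) π)
positive-bump i pos = All.map⁺ (All.map (λ {x} 1≤x → ≤-trans 1≤x (≤-bump i x)) pos)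

ρ-positiveUnique : ∀ j → 1 ≤ i → PositiveUnique π → PositiveUnique (ρ i j π)
ρ-positiveUnique {i} j 1≤i (pos , u) =
  All-insertAt (j ∸ 1) 1≤i (positive-bump i pos) ,
  Unique-insertAt (j ∸ 1) (All.map⁺ (All.tabulate (λ {x} _ → i≢bump i x)))
                          (Unique.map⁺ (bump-injective i) u)

ψ-positiveUnique : Dom y π → PositiveUnique π → PositiveUnique (ψ y π)
ψ-positiveUnique {L1} _                                          = ρ-positiveUnique 1 (s≤s z≤n)
ψ-positiveUnique {L2} _                                          = ρ-positiveUnique 2 (s≤s z≤n)
ψ-positiveUnique {Lu} (_ , _ , _ , _ , refl , _) v@(1≤a ∷ _ , _) = ρ-positiveUnique 1 1≤a v
ψ-positiveUnique {Ld} _                                          = ρ-positiveUnique 1 (s≤s z≤n)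

ψ-nonEmpty : ∀ y π → NonEmpty (ψ y π)
ψ-nonEmpty L1 π = ρ-nonEmpty 1 1 π
ψ-nonEmpty L2 π = ρ-nonEmpty 1 2 π
ψ-nonEmpty Lu π = ρ-nonEmpty (first π) 1 π
ψ-nonEmpty Ld π = ρ-nonEmpty (suc (first π)) 1 π

Q4 : ℕ → ℕ → ℕ → ℕ → List ℕ
Q4 a b c d = a ∷ b ∷ c ∷ d ∷ []

-- Occurrences are explicit quadruples (unlike Contains), so that lookup computes on them.
data Occurs (σ : Perm) (p : List ℕ) : Set where
  occurs : Q4 a b c d ⊆ σ → OrderIso (Q4 a b c d) p → Occurs σ p

data OccursLedBy (h : ℕ) (σ : Perm) (p : List ℕ) : Set where
  occursLedBy : (b ∷ c ∷ d ∷ []) ⊆ σ → OrderIso (Q4 h b c d) p → OccursLedBy h σ p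

occurs-∷⁻ : Occurs (h ∷ σ) p → Occurs σ p ⊎ OccursLedBy h σ p
occurs-∷⁻ (occurs (_ ∷ʳ s) iso) = inj₁ (occurs s iso)
occurs-∷⁻ (occurs (refl ∷ s) iso) = inj₂ (occursLedBy s iso)

orderIso-Q4-transfer : ∀ {a' b' c' d'} →
  (∀ i j → (lookup (Q4 a' b' c' d') i < lookup (Q4 a' b' c' d') j)
         ⇔ (lookup (Q4 a b c d) i < lookup (Q4 a b c d) j)) →
  OrderIso (Q4 a b c d) p → OrderIso (Q4 a' b' c' d') p
orderIso-Q4-transfer same (eq , iso) = eq , λ i j → ⇔.trans (same i j) (iso i j)

orderIso-map⁻ : ∀ {f} → StrictlyMonotone f →
  OrderIso (Q4 (f a) (f b) (f c) (f d)) p → OrderIso (Q4 a b c d) p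
orderIso-map⁻ {a} {b} {c} {d} {p} {f} mono = orderIso-Q4-transfer {p = p} λ i j →
  subst₂ (λ u v → (lookup (Q4 a b c d) i < lookup (Q4 a b c d) j) ⇔ (u < v))
         (lookup-map i) (lookup-map j) mono
  where
  lookup-map : ∀ i → f (lookup (Q4 a b c d) i) ≡ lookup (Q4 (f a) (f b) (f c) (f d)) i
  lookup-map zero                   = refl
  lookup-map (suc zero)             = refl
  lookup-map (suc (suc zero))       = refl
  lookup-map (suc (suc (suc zero))) = refl

⊆-map⁻ : ∀ {f : ℕ → ℕ} {ys xs} → ys ⊆ map f xs →
  ∃ λ zs → zs ⊆ xs × Pointwise (λ y z → y ≡ f z) ys zs
⊆-map⁻ {xs = []}     []         = [] , [] , []
⊆-map⁻ {xs = x ∷ xs} (_ ∷ʳ s)   = let zs , s' , eqs = ⊆-map⁻ s in zs , x ∷ʳ s' , eqs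
⊆-map⁻ {xs = x ∷ xs} (refl ∷ s) = let zs , s' , eqs = ⊆-map⁻ s in x ∷ zs , refl ∷ s' , refl ∷ eqs

occurs-map⁻ : ∀ {f} → StrictlyMonotone f → Occurs (map f π) p → Occurs π p
occurs-map⁻ {p = p} mono (occurs s iso) with ⊆-map⁻ s
... | _ , s' , refl ∷ refl ∷ refl ∷ refl ∷ [] = occurs s' (orderIso-map⁻ {p = p} mono iso)

ComparesAlike : ℕ → ℕ → ℕ → Set
ComparesAlike h h' x = ((x < h') ⇔ (x < h)) × ((h' < x) ⇔ (h < x))

orderIso-replaceHead : All (ComparesAlike h h') (b ∷ c ∷ d ∷ []) →
  OrderIso (Q4 h b c d) p → OrderIso (Q4 h' b c d) p
orderIso-replaceHead {h} {h'} {b} {c} {d} {p} (cb ∷ cc ∷ cd ∷ []) = orderIso-Q4-transfer {p = p} same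
  where
  same : ∀ i j → (lookup (Q4 h' b c d) i < lookup (Q4 h' b c d) j)
               ⇔ (lookup (Q4 h b c d) i < lookup (Q4 h b c d) j)
  same zero zero                   = both-fail (<-irrefl refl) (<-irrefl refl)
  same zero (suc zero)             = proj₂ cb
  same zero (suc (suc zero))       = proj₂ cc
  same zero (suc (suc (suc zero))) = proj₂ cd
  same (suc zero) zero             = proj₁ cb
  same (suc (suc zero)) zero       = proj₁ cc
  same (suc (suc (suc zero))) zero = proj₁ cd
  same (suc i) (suc j)             = ⇔.refl

data RectPattern : List ℕ → Set where
  p2413 : RectPattern (2 ∷ 4 ∷ 1 ∷ 3 ∷ [])
  p2431 : RectPattern (2 ∷ 4 ∷ 3 ∷ 1 ∷ [])
  p4213 : RectPattern (4 ∷ 2 ∷ 1 ∷ 3 ∷ [])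
  p4231 : RectPattern (4 ∷ 2 ∷ 3 ∷ 1 ∷ [])

Below : ℕ → ℕ → ℕ → Set
Below x a b = x < a × x < b

Between : ℕ → ℕ → ℕ → Set
Between x a b = (a < x × x < b) ⊎ (b < x × x < a)

rectPattern-shape : RectPattern p → OrderIso (Q4 a b c d) p →
  (Below c a b ⊎ Below d a b) × (Between c a b ⊎ Between d a b)
rectPattern-shape p2413 (_ , iso) =
  inj₁ (from (iso (# 2) (# 0)) (s<s z<s) , from (iso (# 2) (# 1)) (s<s z<s)) ,
  inj₂ (inj₁ (from (iso (# 0) (# 3)) (s<s (s<s z<s)) , from (iso (# 3) (# 1)) (s<s (s<s (s<s z<s)))))
rectPattern-shape p2431 (_ , iso) =
  inj₂ (from (iso (# 3) (# 0)) (s<s z<s) , from (iso (# 3) (# 1)) (s<s z<s)) ,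
  inj₁ (inj₁ (from (iso (# 0) (# 2)) (s<s (s<s z<s)) , from (iso (# 2) (# 1)) (s<s (s<s (s<s z<s)))))
rectPattern-shape p4213 (_ , iso) =
  inj₁ (from (iso (# 2) (# 0)) (s<s z<s) , from (iso (# 2) (# 1)) (s<s z<s)) ,
  inj₂ (inj₂ (from (iso (# 1) (# 3)) (s<s (s<s z<s)) , from (iso (# 3) (# 0)) (s<s (s<s (s<s z<s)))))
rectPattern-shape p4231 (_ , iso) =
  inj₂ (from (iso (# 3) (# 0)) (s<s z<s) , from (iso (# 3) (# 1)) (s<s z<s)) ,
  inj₁ (inj₂ (from (iso (# 1) (# 2)) (s<s (s<s z<s)) , from (iso (# 2) (# 0)) (s<s (s<s (s<s z<s)))))

contains⇒occurs : RectPattern p → Contains σ p → Occurs σ p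
contains⇒occurs {p} {σ} rp (ys , s , iso) = go ys s iso (trans (proj₁ iso) (length-4 rp))
  where
  length-4 : RectPattern p → length p ≡ 4
  length-4 p2413 = refl
  length-4 p2431 = refl
  length-4 p4213 = refl
  length-4 p4231 = refl
  go : ∀ ys → ys ⊆ σ → OrderIso ys p → length ys ≡ 4 → Occurs σ p
  go (a ∷ b ∷ c ∷ d ∷ [])    s iso _ = occurs s iso
  go []                      _ _ ()
  go (_ ∷ [])                _ _ ()
  go (_ ∷ _ ∷ [])            _ _ ()
  go (_ ∷ _ ∷ _ ∷ [])        _ _ ()
  go (_ ∷ _ ∷ _ ∷ _ ∷ _ ∷ _) _ _ ()

occurs⇒contains : Occurs σ p → Contains σ p
occurs⇒contains (occurs s iso) = _ , s , iso

PullsBack : Perm → Perm → Set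
PullsBack σ π = ∀ {p} → RectPattern p → Occurs σ p → Occurs π p

pullsBack⇒rect : PullsBack σ π → Rect π → Rect σ
pullsBack⇒rect {σ} {π} back (r₁ , r₂ , r₃ , r₄) =
  avoid p2413 r₁ , avoid p2431 r₂ , avoid p4213 r₃ , avoid p4231 r₄
  where
  avoid : RectPattern p → Avoids π p → Avoids σ p
  avoid rp r c = r (occurs⇒contains (back rp (contains⇒occurs rp c)))

rect-[] : Rect []
rect-[] = avoid p2413 , avoid p2431 , avoid p4213 , avoid p4231
  where
  avoid : RectPattern p → Avoids [] p
  avoid rp c with contains⇒occurs rp c
  ... | occurs () _

-- Preservation of rectangularity

not-below-1 : 1 ≤ c → 1 ≤ d → a ≡ 1 ⊎ b ≡ 1 → ¬ (Below c a b ⊎ Below d a b)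
not-below-1 1≤c 1≤d one = Sum.[ below⊥ 1≤c one , below⊥ 1≤d one ]
  where
  below⊥ : ∀ {x} → 1 ≤ x → a ≡ 1 ⊎ b ≡ 1 → ¬ Below x a b
  below⊥ 1≤x (inj₁ refl) (x<1 , _) = <⇒≱ x<1 1≤x
  below⊥ 1≤x (inj₂ refl) (_ , x<1) = <⇒≱ x<1 1≤x

ρ₁₁-pullsBack : Positive π → PullsBack (ρ 1 1 π) π
ρ₁₁-pullsBack {π} pos rp o with occurs-∷⁻ o
... | inj₁ o' = occurs-map⁻ (bump-strictlyMonotone 1) o'
... | inj₂ (occursLedBy s iso) with All-resp-⊆ s (positive-bump 1 pos)
...   | _ ∷ 1≤c ∷ 1≤d ∷ [] = ⊥-elim (not-below-1 1≤c 1≤d (inj₁ refl) (proj₁ (rectPattern-shape rp iso)))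

ρ₁₂-pullsBack : Positive (a ∷ b ∷ rest) → PullsBack (ρ 1 2 (a ∷ b ∷ rest)) (a ∷ b ∷ rest)
ρ₁₂-pullsBack pos rp (occurs (_ ∷ʳ (_ ∷ʳ s)) iso) =
  occurs-map⁻ (bump-strictlyMonotone 1) (occurs (_ ∷ʳ s) iso)
ρ₁₂-pullsBack pos rp (occurs (refl ∷ (_ ∷ʳ s)) iso) =
  occurs-map⁻ (bump-strictlyMonotone 1) (occurs (refl ∷ s) iso)
ρ₁₂-pullsBack (_ ∷ pos) rp (occurs (_ ∷ʳ (refl ∷ s)) iso) with All-resp-⊆ s (positive-bump 1 pos)
... | _ ∷ 1≤c ∷ 1≤d ∷ [] = ⊥-elim (not-below-1 1≤c 1≤d (inj₁ refl) (proj₁ (rectPattern-shape rp iso)))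
ρ₁₂-pullsBack (_ ∷ pos) rp (occurs (refl ∷ (refl ∷ s)) iso) with All-resp-⊆ s (positive-bump 1 pos)
... | 1≤c ∷ 1≤d ∷ [] = ⊥-elim (not-below-1 1≤c 1≤d (inj₂ refl) (proj₁ (rectPattern-shape rp iso)))

Adjacent : ℕ → ℕ → Set
Adjacent m n = n ≡ suc m ⊎ m ≡ suc n

adjacent⇒¬between : ∀ {m n} → Adjacent m n → ¬ Between x m n
adjacent⇒¬between (inj₁ refl) (inj₁ (m<x , x<n)) = <⇒≱ m<x (m<1+n⇒m≤n x<n)
adjacent⇒¬between (inj₁ refl) (inj₂ (n<x , x<m)) = <-asym (<-trans (n<1+n _) n<x) x<m
adjacent⇒¬between (inj₂ refl) (inj₁ (m<x , x<n)) = <-asym (<-trans (n<1+n _) m<x) x<n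
adjacent⇒¬between (inj₂ refl) (inj₂ (n<x , x<m)) = <⇒≱ n<x (m<1+n⇒m≤n x<m)

comparesAlike-suc : x ≢ h → x ≢ suc h → ComparesAlike h (suc h) x
comparesAlike-suc {x} {h} x≢h x≢1+h with <-cmp x h
... | tri< x<h _ _ =
  both-hold (m<n⇒m<1+n x<h) x<h , both-fail (λ 1+h<x → <-asym x<h (<-trans (n<1+n h) 1+h<x)) (<-asym x<h)
... | tri≈ _ x≡h _ = ⊥-elim (x≢h x≡h)
... | tri> _ _ h<x =
  both-fail (λ x<1+h → <⇒≱ h<x (m<1+n⇒m≤n x<1+h)) (<-asym h<x) ,
  both-hold (≤∧≢⇒< h<x (≢-sym x≢1+h)) h<x

adjacent-comparesAlike : Adjacent h h' → x ≢ h → x ≢ h' → ComparesAlike h h' x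
adjacent-comparesAlike (inj₁ refl) x≢h x≢h' = comparesAlike-suc x≢h x≢h'
adjacent-comparesAlike (inj₂ refl) x≢h x≢h' =
  let alike , alike' = comparesAlike-suc x≢h' x≢h in ⇔.sym alike , ⇔.sym alike'

adjacentInsert-pullsBack : All (a ≢_) rest → Adjacent i (bump i a) →
  PullsBack (i ∷ map (bump i) (a ∷ rest)) (a ∷ rest)
adjacentInsert-pullsBack {a} {rest} {i} a∉ adj {p} rp o with occurs-∷⁻ o
... | inj₁ o' = occurs-map⁻ (bump-strictlyMonotone i) o'
... | inj₂ (occursLedBy (refl ∷ _) iso) =
  ⊥-elim (Sum.[ adjacent⇒¬between adj , adjacent⇒¬between adj ] (proj₂ (rectPattern-shape rp iso)))
... | inj₂ (occursLedBy (_ ∷ʳ s) iso) with ⊆-map⁻ s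
...   | _ , s' , refl ∷ refl ∷ refl ∷ [] with All-resp-⊆ s' a∉
...     | a≢b ∷ a≢c ∷ a≢d ∷ [] =
  occurs-map⁻ (bump-strictlyMonotone i)
    (occurs (refl ∷ s) (orderIso-replaceHead {p = p} (alike a≢b ∷ alike a≢c ∷ alike a≢d ∷ []) iso))
  where
  alike : ∀ {z} → a ≢ z → ComparesAlike i (bump i a) (bump i z)
  alike {z} a≢z = adjacent-comparesAlike adj (≢-sym (i≢bump i z)) (λ e → a≢z (sym (bump-injective i e)))

ψ-rect : Dom y π → PositiveUnique π → Rect (ψ y π)
ψ-rect {L1} rect (pos , _) = pullsBack⇒rect (ρ₁₁-pullsBack pos) rect
ψ-rect {L2} (rect , _ , _ , _ , refl , _) (pos , _) = pullsBack⇒rect (ρ₁₂-pullsBack pos) rect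
ψ-rect {Lu} (rect , a , _ , _ , refl , _) (_ , a∉ ∷ _) =
  pullsBack⇒rect (adjacentInsert-pullsBack a∉ (inj₁ (bump-above ≤-refl))) rect
ψ-rect {Ld} (rect , a , _ , refl) (_ , a∉ ∷ _) =
  pullsBack⇒rect (adjacentInsert-pullsBack a∉ (inj₂ (cong suc (sym (bump-below (n<1+n a)))))) rect

ψ-bigNot1 : y ≢ L1 → Dom y π → PositiveUnique π → BigNot1 (ψ y π)
ψ-bigNot1 {L1} y≢L1 _ _ = ⊥-elim (y≢L1 refl)
ψ-bigNot1 {L2} _ (_ , a , _ , _ , refl , _) _ = bump 1 a , 1 , _ , refl , ≢-sym (i≢bump 1 a)
ψ-bigNot1 {Lu} _ (_ , a , _ , _ , refl , a≢1) _ = a , _ , _ , refl , a≢1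
ψ-bigNot1 {Ld} _ (_ , a , _ , refl) (1≤a ∷ _ , _) = suc a , _ , _ , refl , λ e → <-irrefl (sym (suc-injective e)) 1≤a

-- Words of L_Rect

data Guarded : Letter → Set where
  guard-2 : Guarded L2
  guard-u : Guarded Lu

guarded-head : ∀ {g v} → Guarded g → y ∷ w ≡ g ∷ v → Guarded y
guarded-head g e = subst Guarded (sym (∷-injectiveˡ e)) g

StartsWith1 : List Letter → Set
StartsWith1 w = ∃ λ s → w ≡ L1 ∷ s

data RectWord : List Letter → Set where
  [1]     : RectWord [ L1 ]
  1∷_     : RectWord w → RectWord (L1 ∷ w)
  d∷_     : RectWord w → RectWord (Ld ∷ w)
  guarded : Guarded y → RectWord w → ¬ StartsWith1 w → RectWord (y ∷ w)

rectWord-nonEmpty : RectWord w → w ≢ []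
rectWord-nonEmpty [1]             ()
rectWord-nonEmpty (1∷ _)          ()
rectWord-nonEmpty (d∷ _)          ()
rectWord-nonEmpty (guarded _ _ _) ()

guarded-dom : Guarded y → Rect π × BigNot1 π → Dom y π
guarded-dom guard-2 dom = dom
guarded-dom guard-u dom = dom

applies-positiveUnique : Applies w σ → PositiveUnique σ
applies-positiveUnique a-nil           = [] , []
applies-positiveUnique (a-cons ap dom) = ψ-positiveUnique dom (applies-positiveUnique ap)

applies-nonEmpty : Applies w σ → w ≢ [] → NonEmpty σ
applies-nonEmpty a-nil                   w≢[] = ⊥-elim (w≢[] refl)
applies-nonEmpty (a-cons {y} {π = π} _ _) _    = ψ-nonEmpty y π

applies-bigNot1 : Applies w σ → w ≢ [] → ¬ StartsWith1 w → BigNot1 σ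
applies-bigNot1 a-nil           w≢[] _  = ⊥-elim (w≢[] refl)
applies-bigNot1 (a-cons ap dom) _    ¬1 =
  ψ-bigNot1 (λ y≡L1 → ¬1 (_ , cong (_∷ _) y≡L1)) dom (applies-positiveUnique ap)

applies-¬startsWith1 : Applies w σ → BigNot1 σ → ¬ StartsWith1 w
applies-¬startsWith1 (a-cons _ _) (_ , _ , _ , e , a≢1) (_ , refl) = a≢1 (sym (cong first e))

applies-rectWord : Applies (y ∷ w) σ → RectWord (y ∷ w)
applies-rectWord (a-cons {L1} a-nil _)           = [1]
applies-rectWord (a-cons {L1} ap@(a-cons _ _) _) = 1∷ applies-rectWord ap
applies-rectWord (a-cons {Ld} a-nil (_ , _ , _ , ()))
applies-rectWord (a-cons {Ld} ap@(a-cons _ _) _) = d∷ applies-rectWord ap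
applies-rectWord (a-cons {L2} a-nil (_ , _ , _ , _ , () , _))
applies-rectWord (a-cons {L2} ap@(a-cons _ _) (_ , bn)) =
  guarded guard-2 (applies-rectWord ap) (applies-¬startsWith1 ap bn)
applies-rectWord (a-cons {Lu} a-nil (_ , _ , _ , _ , () , _))
applies-rectWord (a-cons {Lu} ap@(a-cons _ _) (_ , bn)) =
  guarded guard-u (applies-rectWord ap) (applies-¬startsWith1 ap bn)

extend : Applies w π → Dom y π → Σ Perm λ σ → Applies (y ∷ w) σ × Rect σ
extend ap dom = _ , a-cons ap dom , ψ-rect dom (applies-positiveUnique ap)

rectWord-applies : RectWord w → Σ Perm λ σ → Applies w σ × Rect σ
rectWord-applies [1] = extend a-nil rect-[]
rectWord-applies (1∷ r) =
  let _ , ap , rect = rectWord-applies r in extend ap rect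
rectWord-applies (d∷ r) =
  let _ , ap , rect = rectWord-applies r in extend ap (rect , applies-nonEmpty ap (rectWord-nonEmpty r))
rectWord-applies (guarded g r ¬1) =
  let _ , ap , rect = rectWord-applies r
  in  extend ap (guarded-dom g (rect , applies-bigNot1 ap (rectWord-nonEmpty r) ¬1))

lrect⇒rectWord : ∀ w → LRect w → RectWord w
lrect⇒rectWord []      (w≢[] , _)   = ⊥-elim (w≢[] refl)
lrect⇒rectWord (_ ∷ _) (_ , _ , ap) = applies-rectWord ap

rectWord⇒lrect : RectWord w → LRect w
rectWord⇒lrect r = rectWord-nonEmpty r , let σ , ap , _ = rectWord-applies r in σ , ap

lrect⇔rectWord : ∀ w → LRect w ⇔ RectWord w
lrect⇔rectWord w = mk⇔ (lrect⇒rectWord w) rectWord⇒lrect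

-- Forbidden factors

hasFactor-∷ : ∀ {f} → HasFactor w f → HasFactor (y ∷ w) f
hasFactor-∷ (p , s , e) = _ ∷ p , s , cong (_ ∷_) e

¬hasFactor-[] : ∀ {f} → ¬ HasFactor [] (y ∷ f)
¬hasFactor-[] ([] , _ , ())
¬hasFactor-[] (_ ∷ _ , _ , ())

¬hasFactor-∷ : ∀ {f} → (∀ s → y ∷ w ≢ f ++ s) → ¬ HasFactor w f → ¬ HasFactor (y ∷ w) f
¬hasFactor-∷ ¬prefix _      ([] , s , e)    = ¬prefix s e
¬hasFactor-∷ _      ¬factor (_ ∷ p , s , e) = ¬factor (p , s , ∷-injectiveʳ e)

rectWord-endsIn1 : RectWord w → EndsIn1 w
rectWord-endsIn1 [1]             = [] , refl
rectWord-endsIn1 (1∷ r)          = let v , e = rectWord-endsIn1 r in L1 ∷ v , cong (L1 ∷_) e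
rectWord-endsIn1 (d∷ r)          = let v , e = rectWord-endsIn1 r in Ld ∷ v , cong (Ld ∷_) e
rectWord-endsIn1 (guarded _ r _) = let v , e = rectWord-endsIn1 r in _ ∷ v , cong (_ ∷_) e

rectWord-¬guarded1 : ∀ {g} → Guarded g → RectWord w → ¬ HasFactor w (g ∷ L1 ∷ [])
rectWord-¬guarded1 g [1]              = ¬hasFactor-∷ (λ _ ()) ¬hasFactor-[]
rectWord-¬guarded1 g (1∷ r)           =
  ¬hasFactor-∷ (λ _ e → case guarded-head g e of λ ()) (rectWord-¬guarded1 g r)
rectWord-¬guarded1 g (d∷ r)           =
  ¬hasFactor-∷ (λ _ e → case guarded-head g e of λ ()) (rectWord-¬guarded1 g r)
rectWord-¬guarded1 g (guarded _ r ¬1) =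
  ¬hasFactor-∷ (λ s e → ¬1 (s , ∷-injectiveʳ e)) (rectWord-¬guarded1 g r)

rectWord⇒desc1 : RectWord w → Desc1 w
rectWord⇒desc1 r = rectWord-endsIn1 r , rectWord-¬guarded1 guard-2 r , rectWord-¬guarded1 guard-u r

desc1-∷⁻ : ∀ {z} → Desc1 (y ∷ z ∷ w) → Desc1 (z ∷ w)
desc1-∷⁻ (([] , ()) , _)
desc1-∷⁻ ((_ ∷ v , e) , ¬21 , ¬u1) = (v , ∷-injectiveʳ e) , ¬21 ∘ hasFactor-∷ , ¬u1 ∘ hasFactor-∷

rectWord-∷ : ∀ {z} → RectWord (z ∷ w) → Desc1 (y ∷ z ∷ w) → RectWord (y ∷ z ∷ w)
rectWord-∷ {y = L1} r _             = 1∷ r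
rectWord-∷ {y = Ld} r _             = d∷ r
rectWord-∷ {y = L2} r (_ , ¬21 , _) = guarded guard-2 r λ (s , e) → ¬21 ([] , s , cong (L2 ∷_) e)
rectWord-∷ {y = Lu} r (_ , _ , ¬u1) = guarded guard-u r λ (s , e) → ¬u1 ([] , s , cong (Lu ∷_) e)

desc1⇒rectWord : ∀ w → Desc1 w → RectWord w
desc1⇒rectWord []            (([] , ()) , _)
desc1⇒rectWord []            ((_ ∷ _ , ()) , _)
desc1⇒rectWord (_ ∷ [])      (([] , refl) , _) = [1]
desc1⇒rectWord (_ ∷ [])      ((_ ∷ [] , ()) , _)
desc1⇒rectWord (_ ∷ [])      ((_ ∷ _ ∷ _ , ()) , _)
desc1⇒rectWord (_ ∷ z ∷ w) d = rectWord-∷ (desc1⇒rectWord (z ∷ w) (desc1-∷⁻ d)) d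

rectWord⇔desc1 : ∀ w → RectWord w ⇔ Desc1 w
rectWord⇔desc1 w = mk⇔ rectWord⇒desc1 (desc1⇒rectWord w)

-- The regular expression

Ones Climb Block : Regex
Ones  = chr L1 *ᴿ
Climb = chr L2 ∣ᴿ chr Lu
Block = (Ones ·ᴿ (Climb *ᴿ)) ·ᴿ chr Ld

climb-guarded : ∀ {u} → u ∈ᴿ Climb → ∃ λ y → u ≡ [ y ] × Guarded y
climb-guarded (m-altˡ m-chr) = L2 , refl , guard-2
climb-guarded (m-altʳ m-chr) = Lu , refl , guard-u

guarded-climb : Guarded y → [ y ] ∈ᴿ Climb
guarded-climb guard-2 = m-altˡ m-chr
guarded-climb guard-u = m-altʳ m-chr

ones⁺-rectWord : ∀ {o} → o ∈ᴿ Ones → RectWord (L1 ∷ o)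
ones⁺-rectWord m-nil             = [1]
ones⁺-rectWord (m-star m-chr mo) = 1∷ ones⁺-rectWord mo

climbs-rectWord : ∀ {q v} → q ∈ᴿ (Climb *ᴿ) → RectWord v →
  RectWord ((q ++ [ Ld ]) ++ v) × ¬ StartsWith1 ((q ++ [ Ld ]) ++ v)
climbs-rectWord m-nil r = d∷ r , λ ()
climbs-rectWord (m-star mc mq) r with climb-guarded mc | climbs-rectWord mq r
... | _ , refl , guard-2 | r' , ¬1 = guarded guard-2 r' ¬1 , λ ()
... | _ , refl , guard-u | r' , ¬1 = guarded guard-u r' ¬1 , λ ()

block-rectWord : ∀ {b v} → b ∈ᴿ Block → RectWord v → RectWord (b ++ v)
block-rectWord (m-cat (m-cat mo mq) m-chr) r = ones-rectWord mo (proj₁ (climbs-rectWord mq r))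
  where
  ones-rectWord : ∀ {o q v} → o ∈ᴿ Ones → RectWord ((q ++ [ Ld ]) ++ v) → RectWord (((o ++ q) ++ [ Ld ]) ++ v)
  ones-rectWord m-nil             r = r
  ones-rectWord (m-star m-chr mo) r = 1∷ ones-rectWord mo r

blocks-rectWord : ∀ {u v} → u ∈ᴿ (Block *ᴿ) → RectWord v → RectWord (u ++ v)
blocks-rectWord m-nil r = r
blocks-rectWord {v = v} (m-star {b} {u} mb mu) r =
  subst RectWord (sym (++-assoc b u v)) (block-rectWord mb (blocks-rectWord mu r))

regex⇒rectWord : w ∈ᴿ RectRegex → RectWord w
regex⇒rectWord (m-cat mbs (m-cat m-chr mo)) = blocks-rectWord mbs (ones⁺-rectWord mo)

rectRegex-1∷ : w ∈ᴿ RectRegex → (L1 ∷ w) ∈ᴿ RectRegex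
rectRegex-1∷ (m-cat m-nil (m-cat m-chr mo)) = m-cat m-nil (m-cat m-chr (m-star m-chr mo))
rectRegex-1∷ (m-cat (m-star (m-cat (m-cat mo mq) m-chr) mbs) mo′) =
  m-cat (m-star (m-cat (m-cat (m-star m-chr mo) mq) m-chr) mbs) mo′

rectRegex-block : ∀ {b} → b ∈ᴿ Block → w ∈ᴿ RectRegex → (b ++ w) ∈ᴿ RectRegex
rectRegex-block {b = b} mb (m-cat {u} {v} mbs mo) =
  subst (_∈ᴿ RectRegex) (++-assoc b u v) (m-cat (m-star mb mbs) mo)

mutual
  rectWord⇒regex : RectWord w → w ∈ᴿ RectRegex
  rectWord⇒regex [1]    = m-cat m-nil (m-cat m-chr m-nil)
  rectWord⇒regex (1∷ r) = rectRegex-1∷ (rectWord⇒regex r)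
  rectWord⇒regex (d∷ r) = rectRegex-block (m-cat (m-cat m-nil m-nil) m-chr) (rectWord⇒regex r)
  rectWord⇒regex (guarded g r ¬1) with climbs-split r ¬1
  ... | _ , _ , refl , mq , mv =
    rectRegex-block (m-cat (m-cat m-nil (m-star (guarded-climb g) mq)) m-chr) mv

  climbs-split : RectWord w → ¬ StartsWith1 w →
    ∃ λ q → ∃ λ v → w ≡ (q ++ [ Ld ]) ++ v × q ∈ᴿ (Climb *ᴿ) × v ∈ᴿ RectRegex
  climbs-split [1]    ¬1 = ⊥-elim (¬1 (_ , refl))
  climbs-split (1∷ _) ¬1 = ⊥-elim (¬1 (_ , refl))
  climbs-split (d∷ r) _  = [] , _ , refl , m-nil , rectWord⇒regex r
  climbs-split (guarded g r ¬1) _ with climbs-split r ¬1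
  ... | q , v , refl , mq , mv = _ ∷ q , v , refl , m-star (guarded-climb g) mq , mv

rectWord⇔regex : ∀ w → RectWord w ⇔ (w ∈ᴿ RectRegex)
rectWord⇔regex w = mk⇔ rectWord⇒regex regex⇒rectWord

mainTheorem2 : (w : List Letter) → (LRect w ⇔ Desc1 w) × (LRect w ⇔ (w ∈ᴿ RectRegex))
mainTheorem2 w =
  ⇔.trans (lrect⇔rectWord w) (rectWord⇔desc1 w) ,
  ⇔.trans (lrect⇔rectWord w) (rectWord⇔regex w)
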